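{- Let $\Pi\Rightarrow C$ be a sequent in which every subformula of the form $!B$ has $B$ a monoidal implication. Then $\Pi\Rightarrow C$ is derivable in $!\mathbf{ACT}_\omega$ if and only if the d-sequent $\varnothing;\Pi\Rightarrow C$ (with empty $!$-zone) is derivable in $!_{\mathrm d}\mathbf{ACT}_\omega^{\mathrm m}$.
   Context: Formulas are built from a countable set of variables and constants $0,1$ using binary $\backslash$, $/$, $\cdot$, $\oplus$, $\&$, unary postfix ${}^*$ and unary prefix $!$. A monoidal implication is a formula $(b_1\cdot\ldots\cdot b_n)\backslash(c_1\cdot\ldots\cdot c_m)$ with $n,m\ge0$ and $b_i,c_j$ variables (an empty product stands for $1$). A sequent is $\Pi\Rightarrow B$ ($\Pi$ a finite, possibly empty, sequence of formulas); $A^n$ is $n$ copies of $A$; $!\Pi$ is a sequence of formulas of the form $!A$. $!\mathbf{ACT}_\omega$ has axioms $A\Rightarrow A$, $\ \Rightarrow1$, $\ \Gamma,0,\Delta\Rightarrow C$, $\ \Rightarrow A^*$ and rules (premises / conclusion): ($\backslash L$) $\Pi\Rightarrow A$, $\Gamma,B,\Delta\Rightarrow C$ / $\Gamma,\Pi,A\backslash B,\Delta\Rightarrow C$; ($\backslash R$) $A,\Pi\Rightarrow B$ / $\Pi\Rightarrow A\backslash B$; ($/L$) $\Pi\Rightarrow A$, $\Gamma,B,\Delta\Rightarrow C$ / $\Gamma,B/A,\Pi,\Delta\Rightarrow C$; ($/R$) $\Pi,A\Rightarrow B$ / $\Pi\Rightarrow B/A$; ($\cdot L$) $\Gamma,A,B,\Delta\Rightarrow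 C$ / $\Gamma,A\cdot B,\Delta\Rightarrow C$; ($\cdot R$) $\Gamma\Rightarrow A$, $\Delta\Rightarrow B$ / $\Gamma,\Delta\Rightarrow A\cdot B$; ($1L$) $\Gamma,\Delta\Rightarrow C$ / $\Gamma,1,\Delta\Rightarrow C$; ($\oplus L$) $\Gamma,A_1,\Delta\Rightarrow C$, $\Gamma,A_2,\Delta\Rightarrow C$ / $\Gamma,A_1\oplus A_2,\Delta\Rightarrow C$; ($\oplus R_i$) $\Pi\Rightarrow A_i$ / $\Pi\Rightarrow A_1\oplus A_2$; ($\&L_i$) $\Gamma,A_i,\Delta\Rightarrow C$ / $\Gamma,A_1\&A_2,\Delta\Rightarrow C$; ($\&R$) $\Pi\Rightarrow A_1$, $\Pi\Rightarrow A_2$ / $\Pi\Rightarrow A_1\&A_2$; (${}^*L_\omega$) $(\Gamma,A^n,\Delta\Rightarrow C)_{n\in\omega}$ / $\Gamma,A^*,\Delta\Rightarrow C$; (${}^*R_n$, $n\ge1$) $\Pi_1\Rightarrow A,\dots,\Pi_n\Rightarrow A$ / $\Pi_1,\dots,\Pi_n\Rightarrow A^*$; (Cut) $\Pi\Rightarrow A$, $\Gamma,A,\Delta\Rightarrow C$ / $\Gamma,\Pi,\Delta\Rightarrow C$; ($!L$) $\Gamma,A,\Delta\Rightarrow C$ / $\Gamma,!A,\Delta\Rightarrow C$; ($!R$) $!\Pi\Rightarrow B$ / $!\Pi\Rightarrow!B$; ($!P_1$) $\Gamma,\Pi,!A,\Delta\Rightarrow C$ / $\Gamma,!A,\Pi,\Delta\Rightarrow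 C$; ($!P_2$) $\Gamma,!A,\Pi,\Delta\Rightarrow C$ / $\Gamma,\Pi,!A,\Delta\Rightarrow C$; ($!W$) $\Gamma,\Delta\Rightarrow C$ / $\Gamma,!A,\Delta\Rightarrow C$; ($!C$) $\Gamma,!A,!A,\Delta\Rightarrow C$ / $\Gamma,!A,\Delta\Rightarrow C$. A d-sequent is $!\Xi;\Gamma\Rightarrow C$ where $C$ and the members of $\Gamma$ are formulas in which every subformula $!B$ has $B$ a monoidal implication, and $!\Xi$ is a finite set of formulas $!B$ with $B$ a monoidal implication. The calculus $!_{\mathrm d}\mathbf{ACT}_\omega^{\mathrm m}$ has as axioms and rules the axioms and rules of $!\mathbf{ACT}_\omega$ other than Cut and the $!$-rules, each with the same $!\Xi;$ prefixed to the antecedent of every premise and of the conclusion (e.g. axiom $!\Xi;A\Rightarrow A$; rule ($\cdot R$): $!\Xi;\Gamma\Rightarrow A$, $!\Xi;\Delta\Rightarrow B$ / $!\Xi;\Gamma,\Delta\Rightarrow A\cdot B$; rule (${}^*L_\omega$): $(!\Xi;\Gamma,A^n,\Delta\Rightarrow C)_{n\in\omega}$ / $!\Xi;\Gamma,A^*,\Delta\Rightarrow C$), together with: $(!L)_{\mathrm d}$ $!\Xi\cup\{!A\};\Gamma,\Delta\Rightarrow C$ / $!\Xi;\Gamma,!A,\Delta\Rightarrow C$; $(!R)_{\mathrm d}$ $!\Xi;\ \Rightarrow B$ / $!\Xi;\ \Rightarrow!B$; $(A)_{\mathrm d}$ $!\Xi;\Gamma,c_1,\dots,c_m,\Delta\Rightarrow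 C$ / $\{!((b_1\cdot\ldots\cdot b_n)\backslash(c_1\cdot\ldots\cdot c_m))\}\cup!\Xi;\Gamma,b_1,\dots,b_n,\Delta\Rightarrow C$; $(\mathrm{Cut})_{\mathrm d1}$ $!\Xi;\Pi\Rightarrow A$, $!\Xi;\Gamma,A,\Delta\Rightarrow C$ / $!\Xi;\Gamma,\Pi,\Delta\Rightarrow C$; $(\mathrm{Cut})_{\mathrm d2}$ $!\Xi;\ \Rightarrow B$, $!\Xi\cup\{!B\};\Gamma\Rightarrow C$ / $!\Xi;\Gamma\Rightarrow C$. In both calculi derivable objects form the least set containing the axioms and closed under the rules. -}

module Defs where

open import Data.Nat using (ℕ; suc)
open import Data.Fin using (Fin)
open import Data.List using (List; []; _∷_; _++_; replicate; concat; tabulate; map)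
open import Data.List.Relation.Unary.All using (All)
open import Data.List.Membership.Propositional using (_∈_)
open import Data.Product using (Σ; _×_; ∃)
open import Data.Unit using (⊤)
open import Relation.Binary.PropositionalEquality using (_≡_)

infixr 30 _⊗_
infix 25 _⊕_ _&_
infixr 20 _⟍_
infixl 20 _⟋_

-- Formulas: variables (indexed by ℕ), constants 0,1, and connectives
-- \ (written ⟍), / (written ⟋), · (written ⊗), ⊕, &, postfix *, prefix !.
data Fm : Set where
  var  : ℕ → Fm
  𝟘 𝟙  : Fm
  _⟍_  : Fm → Fm → Fm
  _⟋_  : Fm → Fm → Fm
  _⊗_  : Fm → Fm → Fm
  _⊕_  : Fm → Fm → Fm
  _&_  : Fm → Fm → Fm
  _⋆   : Fm → Fm
  !_   : Fm → Fm

data ProdOf : Fm → List ℕ → Set where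
  p𝟙   : ProdOf 𝟙 []
  pvar : ∀ b → ProdOf (var b) (b ∷ [])
  pmul : ∀ {P Q x xs y ys} → ProdOf P (x ∷ xs) → ProdOf Q (y ∷ ys) →
         ProdOf (P ⊗ Q) (x ∷ xs ++ y ∷ ys)

data MonImp : Fm → Set where
  monimp : ∀ {P Q bs cs} → ProdOf P bs → ProdOf Q cs → MonImp (P ⟍ Q)

Good : Fm → Set
Good (var _) = ⊤
Good 𝟘 = ⊤
Good 𝟙 = ⊤
Good (A ⟍ B) = Good A × Good B
Good (A ⟋ B) = Good A × Good B
Good (A ⊗ B) = Good A × Good B
Good (A ⊕ B) = Good A × Good B
Good (A & B) = Good A × Good B
Good (A ⋆) = Good A
Good (! B) = MonImp B

Banged : List Fm → Set
Banged = All (λ F → ∃ λ A → F ≡ ! A)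

infix 5 _⊢_

data _⊢_ : List Fm → Fm → Set where
  ax   : ∀ A → (A ∷ []) ⊢ A
  ax𝟙  : [] ⊢ 𝟙
  ax𝟘  : ∀ Γ Δ C → (Γ ++ 𝟘 ∷ Δ) ⊢ C
  ax⋆  : ∀ A → [] ⊢ A ⋆
  ⟍L   : ∀ {Π Γ Δ A B C} → Π ⊢ A → (Γ ++ B ∷ Δ) ⊢ C →
         (Γ ++ Π ++ (A ⟍ B) ∷ Δ) ⊢ C
  ⟍R   : ∀ {Π A B} → (A ∷ Π) ⊢ B → Π ⊢ A ⟍ B
  ⟋L   : ∀ {Π Γ Δ A B C} → Π ⊢ A → (Γ ++ B ∷ Δ) ⊢ C →
         (Γ ++ (B ⟋ A) ∷ Π ++ Δ) ⊢ C
  ⟋R   : ∀ {Π A B} → (Π ++ A ∷ []) ⊢ B → Π ⊢ B ⟋ A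
  ⊗L   : ∀ {Γ Δ A B C} → (Γ ++ A ∷ B ∷ Δ) ⊢ C → (Γ ++ (A ⊗ B) ∷ Δ) ⊢ C
  ⊗R   : ∀ {Γ Δ A B} → Γ ⊢ A → Δ ⊢ B → (Γ ++ Δ) ⊢ A ⊗ B
  𝟙L   : ∀ {Γ Δ C} → (Γ ++ Δ) ⊢ C → (Γ ++ 𝟙 ∷ Δ) ⊢ C
  ⊕L   : ∀ {Γ Δ A₁ A₂ C} → (Γ ++ A₁ ∷ Δ) ⊢ C → (Γ ++ A₂ ∷ Δ) ⊢ C →
         (Γ ++ (A₁ ⊕ A₂) ∷ Δ) ⊢ C
  ⊕R₁  : ∀ {Π A₁ A₂} → Π ⊢ A₁ → Π ⊢ A₁ ⊕ A₂
  ⊕R₂  : ∀ {Π A₁ A₂} → Π ⊢ A₂ → Π ⊢ A₁ ⊕ A₂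
  &L₁  : ∀ {Γ Δ A₁ A₂ C} → (Γ ++ A₁ ∷ Δ) ⊢ C → (Γ ++ (A₁ & A₂) ∷ Δ) ⊢ C
  &L₂  : ∀ {Γ Δ A₁ A₂ C} → (Γ ++ A₂ ∷ Δ) ⊢ C → (Γ ++ (A₁ & A₂) ∷ Δ) ⊢ C
  &R   : ∀ {Π A₁ A₂} → Π ⊢ A₁ → Π ⊢ A₂ → Π ⊢ A₁ & A₂
  ⋆Lω  : ∀ {Γ Δ A C} → (∀ n → (Γ ++ replicate n A ++ Δ) ⊢ C) →
         (Γ ++ (A ⋆) ∷ Δ) ⊢ C
  -- *R_n with n = suc k ≥ 1 premises Π_i ⇒ A
  ⋆Rn  : ∀ {A} k (Πs : Fin (suc k) → List Fm) → (∀ i → Πs i ⊢ A) →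
         concat (tabulate Πs) ⊢ A ⋆
  cut  : ∀ {Π Γ Δ A C} → Π ⊢ A → (Γ ++ A ∷ Δ) ⊢ C → (Γ ++ Π ++ Δ) ⊢ C
  !L   : ∀ {Γ Δ A C} → (Γ ++ A ∷ Δ) ⊢ C → (Γ ++ (! A) ∷ Δ) ⊢ C
  !R   : ∀ {Π B} → Banged Π → Π ⊢ B → Π ⊢ ! B
  !P₁  : ∀ {Γ Π Δ A C} → (Γ ++ Π ++ (! A) ∷ Δ) ⊢ C → (Γ ++ (! A) ∷ Π ++ Δ) ⊢ C
  !P₂  : ∀ {Γ Π Δ A C} → (Γ ++ (! A) ∷ Π ++ Δ) ⊢ C → (Γ ++ Π ++ (! A) ∷ Δ) ⊢ C
  !W   : ∀ {Γ Δ A C} → (Γ ++ Δ) ⊢ C → (Γ ++ (! A) ∷ Δ) ⊢ C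
  !C   : ∀ {Γ Δ A C} → (Γ ++ (! A) ∷ (! A) ∷ Δ) ⊢ C → (Γ ++ (! A) ∷ Δ) ⊢ C

-- The !-zone !Ξ is a finite set; it is
-- represented by a list Ξ of the formulas B (the zone being {!B | B ∈ Ξ}),
-- and set union {!B} ∪ !Ξ is expressed up to set equality:
-- Ξ' ≈ B ∷ Ξ  means Ξ' and B ∷ Ξ have the same elements.

_≈_ : List Fm → List Fm → Set
Ξ ≈ Ξ' = ∀ F → (F ∈ Ξ → F ∈ Ξ') × (F ∈ Ξ' → F ∈ Ξ)

infix 5 _︔_⊢ᵈ_

data _︔_⊢ᵈ_ : List Fm → List Fm → Fm → Set where
  ax   : ∀ {Ξ} A → Ξ ︔ A ∷ [] ⊢ᵈ A
  ax𝟙  : ∀ {Ξ} → Ξ ︔ [] ⊢ᵈ 𝟙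
  ax𝟘  : ∀ {Ξ} Γ Δ C → Ξ ︔ Γ ++ 𝟘 ∷ Δ ⊢ᵈ C
  ax⋆  : ∀ {Ξ} A → Ξ ︔ [] ⊢ᵈ A ⋆
  ⟍L   : ∀ {Ξ Π Γ Δ A B C} → Ξ ︔ Π ⊢ᵈ A → Ξ ︔ Γ ++ B ∷ Δ ⊢ᵈ C →
         Ξ ︔ Γ ++ Π ++ (A ⟍ B) ∷ Δ ⊢ᵈ C
  ⟍R   : ∀ {Ξ Π A B} → Ξ ︔ A ∷ Π ⊢ᵈ B → Ξ ︔ Π ⊢ᵈ A ⟍ B
  ⟋L   : ∀ {Ξ Π Γ Δ A B C} → Ξ ︔ Π ⊢ᵈ A → Ξ ︔ Γ ++ B ∷ Δ ⊢ᵈ C →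
         Ξ ︔ Γ ++ (B ⟋ A) ∷ Π ++ Δ ⊢ᵈ C
  ⟋R   : ∀ {Ξ Π A B} → Ξ ︔ Π ++ A ∷ [] ⊢ᵈ B → Ξ ︔ Π ⊢ᵈ B ⟋ A
  ⊗L   : ∀ {Ξ Γ Δ A B C} → Ξ ︔ Γ ++ A ∷ B ∷ Δ ⊢ᵈ C →
         Ξ ︔ Γ ++ (A ⊗ B) ∷ Δ ⊢ᵈ C
  ⊗R   : ∀ {Ξ Γ Δ A B} → Ξ ︔ Γ ⊢ᵈ A → Ξ ︔ Δ ⊢ᵈ B → Ξ ︔ Γ ++ Δ ⊢ᵈ A ⊗ B
  𝟙L   : ∀ {Ξ Γ Δ C} → Ξ ︔ Γ ++ Δ ⊢ᵈ C → Ξ ︔ Γ ++ 𝟙 ∷ Δ ⊢ᵈ C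
  ⊕L   : ∀ {Ξ Γ Δ A₁ A₂ C} → Ξ ︔ Γ ++ A₁ ∷ Δ ⊢ᵈ C → Ξ ︔ Γ ++ A₂ ∷ Δ ⊢ᵈ C →
         Ξ ︔ Γ ++ (A₁ ⊕ A₂) ∷ Δ ⊢ᵈ C
  ⊕R₁  : ∀ {Ξ Π A₁ A₂} → Ξ ︔ Π ⊢ᵈ A₁ → Ξ ︔ Π ⊢ᵈ A₁ ⊕ A₂
  ⊕R₂  : ∀ {Ξ Π A₁ A₂} → Ξ ︔ Π ⊢ᵈ A₂ → Ξ ︔ Π ⊢ᵈ A₁ ⊕ A₂
  &L₁  : ∀ {Ξ Γ Δ A₁ A₂ C} → Ξ ︔ Γ ++ A₁ ∷ Δ ⊢ᵈ C →
         Ξ ︔ Γ ++ (A₁ & A₂) ∷ Δ ⊢ᵈ C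
  &L₂  : ∀ {Ξ Γ Δ A₁ A₂ C} → Ξ ︔ Γ ++ A₂ ∷ Δ ⊢ᵈ C →
         Ξ ︔ Γ ++ (A₁ & A₂) ∷ Δ ⊢ᵈ C
  &R   : ∀ {Ξ Π A₁ A₂} → Ξ ︔ Π ⊢ᵈ A₁ → Ξ ︔ Π ⊢ᵈ A₂ → Ξ ︔ Π ⊢ᵈ A₁ & A₂
  ⋆Lω  : ∀ {Ξ Γ Δ A C} → (∀ n → Ξ ︔ Γ ++ replicate n A ++ Δ ⊢ᵈ C) →
         Ξ ︔ Γ ++ (A ⋆) ∷ Δ ⊢ᵈ C
  ⋆Rn  : ∀ {Ξ A} k (Πs : Fin (suc k) → List Fm) → (∀ i → Ξ ︔ Πs i ⊢ᵈ A) →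
         Ξ ︔ concat (tabulate Πs) ⊢ᵈ A ⋆
  !Lᵈ  : ∀ {Ξ Ξ' Γ Δ A C} → MonImp A → Ξ' ≈ (A ∷ Ξ) →
         Ξ' ︔ Γ ++ Δ ⊢ᵈ C → Ξ ︔ Γ ++ (! A) ∷ Δ ⊢ᵈ C
  !Rᵈ  : ∀ {Ξ B} → Ξ ︔ [] ⊢ᵈ B → Ξ ︔ [] ⊢ᵈ ! B
  Aᵈ   : ∀ {Ξ Ξ' Γ Δ C P Q bs cs} → ProdOf P bs → ProdOf Q cs →
         Ξ' ≈ ((P ⟍ Q) ∷ Ξ) →
         Ξ ︔ Γ ++ map var cs ++ Δ ⊢ᵈ C → Ξ' ︔ Γ ++ map var bs ++ Δ ⊢ᵈ C
  cutᵈ₁ : ∀ {Ξ Π Γ Δ A C} → Good A → Ξ ︔ Π ⊢ᵈ A → Ξ ︔ Γ ++ A ∷ Δ ⊢ᵈ C →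
          Ξ ︔ Γ ++ Π ++ Δ ⊢ᵈ C
  cutᵈ₂ : ∀ {Ξ Ξ' Γ B C} → MonImp B → Ξ' ≈ (B ∷ Ξ) →
          Ξ ︔ [] ⊢ᵈ B → Ξ' ︔ Γ ⊢ᵈ C → Ξ ︔ Γ ⊢ᵈ C

{-# OPTIONS --safe #-}
module Submission where

-- (⇐) Read a d-sequent Ξ ; Γ ⇒ C as the sequent ![ Ξ ] , Γ ⇒ C of !ACT_ω. Every d-rule is then
-- derivable: the zone, duplicated by the rules with several premises, is merged back by
-- permutation and contraction of !-formulas; (A)_d is \L applied to the two products followed by
-- !L; (Cut)_d2 is !R followed by Cut.
--
-- (⇒) Cut is eliminated semantically, after Okada: formulas denote sets of antecedents closed
-- under the closure operator cl induced by cut-free derivability, every rule (cut included) is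
-- sound, and [ A ] ∈ ⟦ A ⟧ ⊆ { Γ | Γ ⇒ A has a cut-free derivation }. A cut-free derivation of a
-- sequent whose !-subformulas are monoidal implications contains only such sequents, and it is
-- translated rule by rule, for an arbitrary zone. A formula !A of the antecedent is moved into the
-- zone by (!L)_d; once A is in the zone, !A is derivable from it by \R, (A)_d and (!R)_d, so
-- (Cut)_d1 on the good formula !A deletes any occurrence of !A. This simulates !P, !W and !C.

open import Defs
open import Data.Bool using (Bool; true; false)
open import Data.Empty using (⊥)
open import Data.Fin using (Fin; zero; suc)
open import Data.List using (List; []; _∷_; _++_; [_]; replicate; concat; tabulate; map)
open import Data.List.Properties using (++-assoc; ++-identityʳ; map-++)
open import Data.List.Relation.Unary.All using (All; []; _∷_)
open import Data.List.Relation.Unary.All.Properties using (++⁺; ++⁻; replicate⁺; concat⁻; tabulate⁻)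
open import Data.List.Relation.Unary.Any using (here; there)
open import Data.List.Membership.Propositional using (_∈_)
open import Data.List.Relation.Binary.Subset.Propositional using (_⊆_)
open import Data.Nat using (ℕ; zero; suc)
open import Data.Product using (Σ; ∃; _×_; _,_; proj₁; proj₂)
open import Data.Sum using (_⊎_; inj₁; inj₂)
open import Data.Unit using (tt)
open import Function.Base using (id; _∘_)
open import Function.Bundles using (_⇔_; mk⇔)
open import Relation.Binary.PropositionalEquality using (_≡_; refl; sym; trans; cong; subst)

variable
  b : Bool
  A B C P Q : Fm
  Γ Γ′ Δ Π G G′ G″ y Ξ : List Fm
  bs cs : List ℕ

infix 4 _⊢[_]_ _⊢ᶜᶠ_

data _⊢[_]_ : List Fm → Bool → Fm → Set where
  ax   : ∀ A → [ A ] ⊢[ b ] A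
  ax𝟙  : [] ⊢[ b ] 𝟙
  ax𝟘  : ∀ Γ Δ C → Γ ++ 𝟘 ∷ Δ ⊢[ b ] C
  ax⋆  : ∀ A → [] ⊢[ b ] A ⋆
  ⟍L   : ∀ {A B} → Π ⊢[ b ] A → Γ ++ B ∷ Δ ⊢[ b ] C → Γ ++ Π ++ (A ⟍ B) ∷ Δ ⊢[ b ] C
  ⟍R   : ∀ {A B} → A ∷ Π ⊢[ b ] B → Π ⊢[ b ] A ⟍ B
  ⟋L   : ∀ {A B} → Π ⊢[ b ] A → Γ ++ B ∷ Δ ⊢[ b ] C → Γ ++ (B ⟋ A) ∷ Π ++ Δ ⊢[ b ] C
  ⟋R   : ∀ {A B} → Π ++ [ A ] ⊢[ b ] B → Π ⊢[ b ] B ⟋ A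
  ⊗L   : ∀ {A B} → Γ ++ A ∷ B ∷ Δ ⊢[ b ] C → Γ ++ (A ⊗ B) ∷ Δ ⊢[ b ] C
  ⊗R   : ∀ {A B} → Γ ⊢[ b ] A → Δ ⊢[ b ] B → Γ ++ Δ ⊢[ b ] A ⊗ B
  𝟙L   : Γ ++ Δ ⊢[ b ] C → Γ ++ 𝟙 ∷ Δ ⊢[ b ] C
  ⊕L   : ∀ {A₁ A₂} → Γ ++ A₁ ∷ Δ ⊢[ b ] C → Γ ++ A₂ ∷ Δ ⊢[ b ] C → Γ ++ (A₁ ⊕ A₂) ∷ Δ ⊢[ b ] C
  ⊕R₁  : ∀ {A₁ A₂} → Π ⊢[ b ] A₁ → Π ⊢[ b ] A₁ ⊕ A₂
  ⊕R₂  : ∀ {A₁ A₂} → Π ⊢[ b ] A₂ → Π ⊢[ b ] A₁ ⊕ A₂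
  &L₁  : ∀ {A₁ A₂} → Γ ++ A₁ ∷ Δ ⊢[ b ] C → Γ ++ (A₁ & A₂) ∷ Δ ⊢[ b ] C
  &L₂  : ∀ {A₁ A₂} → Γ ++ A₂ ∷ Δ ⊢[ b ] C → Γ ++ (A₁ & A₂) ∷ Δ ⊢[ b ] C
  &R   : ∀ {A₁ A₂} → Π ⊢[ b ] A₁ → Π ⊢[ b ] A₂ → Π ⊢[ b ] A₁ & A₂
  ⋆Lω  : ∀ {A} → (∀ n → Γ ++ replicate n A ++ Δ ⊢[ b ] C) → Γ ++ (A ⋆) ∷ Δ ⊢[ b ] C
  ⋆Rn  : ∀ {A} k (Πs : Fin (suc k) → List Fm) → (∀ i → Πs i ⊢[ b ] A) →
         concat (tabulate Πs) ⊢[ b ] A ⋆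
  cut  : ∀ {A} → Π ⊢[ true ] A → Γ ++ A ∷ Δ ⊢[ true ] C → Γ ++ Π ++ Δ ⊢[ true ] C
  !L   : ∀ {A} → Γ ++ A ∷ Δ ⊢[ b ] C → Γ ++ (! A) ∷ Δ ⊢[ b ] C
  !R   : ∀ {B} → Banged Π → Π ⊢[ b ] B → Π ⊢[ b ] ! B
  !P₁  : ∀ {A} → Γ ++ Π ++ (! A) ∷ Δ ⊢[ b ] C → Γ ++ (! A) ∷ Π ++ Δ ⊢[ b ] C
  !P₂  : ∀ {A} → Γ ++ (! A) ∷ Π ++ Δ ⊢[ b ] C → Γ ++ Π ++ (! A) ∷ Δ ⊢[ b ] C
  !W   : ∀ {A} → Γ ++ Δ ⊢[ b ] C → Γ ++ (! A) ∷ Δ ⊢[ b ] C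
  !C   : ∀ {A} → Γ ++ (! A) ∷ (! A) ∷ Δ ⊢[ b ] C → Γ ++ (! A) ∷ Δ ⊢[ b ] C

_⊢ᶜᶠ_ : List Fm → Fm → Set
Γ ⊢ᶜᶠ C = Γ ⊢[ false ] C

embed : Γ ⊢[ b ] C → Γ ⊢ C
embed (ax A) = ax A
embed ax𝟙 = ax𝟙
embed (ax𝟘 Γ Δ C) = ax𝟘 Γ Δ C
embed (ax⋆ A) = ax⋆ A
embed (⟍L d e) = ⟍L (embed d) (embed e)
embed (⟍R d) = ⟍R (embed d)
embed (⟋L d e) = ⟋L (embed d) (embed e)
embed (⟋R d) = ⟋R (embed d)
embed (⊗L d) = ⊗L (embed d)
embed (⊗R d e) = ⊗R (embed d) (embed e)
embed (𝟙L d) = 𝟙L (embed d)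
embed (⊕L d e) = ⊕L (embed d) (embed e)
embed (⊕R₁ d) = ⊕R₁ (embed d)
embed (⊕R₂ d) = ⊕R₂ (embed d)
embed (&L₁ d) = &L₁ (embed d)
embed (&L₂ d) = &L₂ (embed d)
embed (&R d e) = &R (embed d) (embed e)
embed (⋆Lω f) = ⋆Lω (λ n → embed (f n))
embed (⋆Rn k Πs f) = ⋆Rn k Πs (λ i → embed (f i))
embed (cut d e) = cut (embed d) (embed e)
embed (!L d) = !L (embed d)
embed (!R p d) = !R p (embed d)
embed (!P₁ d) = !P₁ (embed d)
embed (!P₂ d) = !P₂ (embed d)
embed (!W d) = !W (embed d)
embed (!C d) = !C (embed d)

cast : Γ ≡ Γ′ → Γ ⊢[ b ] C → Γ′ ⊢[ b ] C
cast refl d = d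

++-regroup : ∀ (Φ L G Ψ : List Fm) → Φ ++ (L ++ G) ++ Ψ ≡ (Φ ++ L) ++ G ++ Ψ
++-regroup Φ L G Ψ = trans (cong (Φ ++_) (++-assoc L G Ψ)) (sym (++-assoc Φ L (G ++ Ψ)))

infix 4 _⇛_

record _⇛_ (G G′ : List Fm) : Set where
  field
    replace : ∀ {b Φ Ψ C} → Φ ++ G ++ Ψ ⊢[ b ] C → Φ ++ G′ ++ Ψ ⊢[ b ] C
open _⇛_

⇛-refl : G ⇛ G
replace ⇛-refl d = d

⇛-trans : G ⇛ G′ → G′ ⇛ G″ → G ⇛ G″
replace (⇛-trans f g) {Φ = Φ} {Ψ} d = replace g {Φ = Φ} {Ψ} (replace f {Φ = Φ} {Ψ} d)

≡⇒⇛ : G ≡ G′ → G ⇛ G′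
replace (≡⇒⇛ refl) d = d

⇛-++ˡ : ∀ L → G ⇛ G′ → L ++ G ⇛ L ++ G′
replace (⇛-++ˡ {G} {G′} L f) {Φ = Φ} {Ψ} d =
  cast (sym (++-regroup Φ L G′ Ψ)) (replace f {Φ = Φ ++ L} (cast (++-regroup Φ L G Ψ) d))

⇛-++ʳ : ∀ R → G ⇛ G′ → G ++ R ⇛ G′ ++ R
replace (⇛-++ʳ {G} {G′} R f) {Φ = Φ} {Ψ} d =
  cast (cong (Φ ++_) (sym (++-assoc G′ R Ψ)))
    (replace f {Φ = Φ} {R ++ Ψ} (cast (cong (Φ ++_) (++-assoc G R Ψ)) d))

⇛-apply : G ⇛ G′ → G ⊢[ b ] C → G′ ⊢[ b ] C
⇛-apply {G} {G′} f d = cast (++-identityʳ G′) (replace f {Φ = []} (cast (sym (++-identityʳ G)) d))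

!W⇛ : Γ ⇛ ! A ∷ Γ
replace !W⇛ {Φ = Φ} = !W {Γ = Φ}

!C⇛ : ! A ∷ ! A ∷ Γ ⇛ ! A ∷ Γ
replace !C⇛ {Φ = Φ} = !C {Γ = Φ}

!L⇛ : [ A ] ⇛ [ ! A ]
replace !L⇛ {Φ = Φ} = !L {Γ = Φ}

⊗L⇛ : A ∷ B ∷ [] ⇛ [ A ⊗ B ]
replace ⊗L⇛ {Φ = Φ} = ⊗L {Γ = Φ}

!P₁⇛ : Γ ++ ! A ∷ Δ ⇛ ! A ∷ Γ ++ Δ
replace (!P₁⇛ {Γ} {A} {Δ}) {Φ = Φ} {Ψ} d =
  cast (cong (λ Θ → Φ ++ ! A ∷ Θ) (sym (++-assoc Γ Δ Ψ)))
    (!P₁ {Γ = Φ} (cast (cong (Φ ++_) (++-assoc Γ (! A ∷ Δ) Ψ)) d))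

!P₂⇛ : ! A ∷ Γ ++ Δ ⇛ Γ ++ ! A ∷ Δ
replace (!P₂⇛ {A} {Γ} {Δ}) {Φ = Φ} {Ψ} d =
  cast (cong (Φ ++_) (sym (++-assoc Γ (! A ∷ Δ) Ψ)))
    (!P₂ {Γ = Φ} (cast (cong (λ Θ → Φ ++ ! A ∷ Θ) (++-assoc Γ Δ Ψ)) d))

!W-block : Banged y → Γ ⇛ y ++ Γ
!W-block [] = ⇛-refl
!W-block ((A , refl) ∷ by) = ⇛-trans (!W-block by) !W⇛

!P₁-block : Banged y → Γ ++ y ++ Δ ⇛ y ++ Γ ++ Δ
!P₁-block [] = ⇛-refl
!P₁-block {Γ = Γ} {Δ = Δ} ((A , refl) ∷ by) =
  ⇛-trans !P₁⇛ (⇛-++ˡ [ ! A ] (!P₁-block {Γ = Γ} {Δ = Δ} by))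

!P₂-block : Banged y → y ++ Γ ++ Δ ⇛ Γ ++ y ++ Δ
!P₂-block [] = ⇛-refl
!P₂-block {Γ = Γ} {Δ = Δ} ((A , refl) ∷ by) =
  ⇛-trans (⇛-++ˡ [ ! A ] (!P₂-block {Γ = Γ} {Δ = Δ} by)) !P₂⇛

!C-block : Banged y → y ++ y ++ Γ ⇛ y ++ Γ
!C-block [] = ⇛-refl
!C-block {y = _ ∷ y′} ((A , refl) ∷ by) =
  ⇛-trans (⇛-++ˡ [ ! A ] (!P₁⇛ {Γ = y′}))
    (⇛-trans !C⇛ (⇛-++ˡ [ ! A ] (!C-block by)))

!merge-block : Banged y → ∀ Γ → y ++ Γ ++ y ++ Δ ⇛ y ++ Γ ++ Δ
!merge-block {y} {Δ} by Γ = ⇛-trans (⇛-++ˡ y (!P₁-block {Γ = Γ} {Δ = Δ} by)) (!C-block by)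

-- Cut elimination through a closure semantics

Pred : Set₁
Pred = List Fm → Set

variable
  X Z Z′ : Pred

ε : Pred
ε Γ = Γ ≡ []

infixr 6 _⊙_
infixr 6 _∙_

data _⊙_ (X Y : Pred) : Pred where
  _∙_ : X Γ → Y Δ → (X ⊙ Y) (Γ ++ Δ)

_^_ : Pred → ℕ → Pred
X ^ zero = ε
X ^ suc n = X ⊙ X ^ n

cl : Pred → Pred
cl X Γ = ∀ Φ Ψ {C} → (∀ {Δ} → X Δ → Φ ++ Δ ++ Ψ ⊢ᶜᶠ C) → Φ ++ Γ ++ Ψ ⊢ᶜᶠ C

Closed : Pred → Set
Closed Z = ∀ {Γ} → cl Z Γ → Z Γ

cl-inc : X Γ → cl X Γ
cl-inc x Φ Ψ k = k x

cl-rec : Closed Z → (∀ {Γ} → X Γ → Z Γ) → cl X Γ → Z Γ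
cl-rec cZ f h = cZ (λ Φ Ψ k → h Φ Ψ (λ x → k (f x)))

cl-closed : Closed (cl X)
cl-closed h Φ Ψ k = h Φ Ψ (λ x → x Φ Ψ k)

⊢ᶜᶠ-closed : Closed (_⊢ᶜᶠ C)
⊢ᶜᶠ-closed {Γ = Γ} h =
  cast (++-identityʳ Γ) (h [] [] (λ {Δ} d → cast (sym (++-identityʳ Δ)) d))

Closed-× : Closed Z → Closed Z′ → Closed (λ Γ → Z Γ × Z′ Γ)
Closed-× cZ cZ′ h = cl-rec cZ proj₁ h , cl-rec cZ′ proj₂ h

Closed-++ˡ : ∀ L → Closed Z → Closed (λ Γ → Z (L ++ Γ))
Closed-++ˡ L cZ {Γ} h = cZ λ Φ Ψ k →
  cast (sym (++-regroup Φ L Γ Ψ))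
    (h (Φ ++ L) Ψ λ {Δ} z → cast (++-regroup Φ L Δ Ψ) (k z))

Closed-++ʳ : ∀ R → Closed Z → Closed (λ Γ → Z (Γ ++ R))
Closed-++ʳ R cZ {Γ} h = cZ λ Φ Ψ k →
  cast (cong (Φ ++_) (sym (++-assoc Γ R Ψ)))
    (h Φ (R ++ Ψ) λ {Δ} z → cast (cong (Φ ++_) (++-assoc Δ R Ψ)) (k z))

cl-rec-in : ∀ L R → Closed Z → (∀ {Γ} → X Γ → Z (L ++ Γ ++ R)) → cl X Γ → Z (L ++ Γ ++ R)
cl-rec-in L R cZ = cl-rec (Closed-++ʳ R (Closed-++ˡ L cZ))

Closed-⇛ : Closed Z → G ⇛ G′ → Z G → Z G′
Closed-⇛ cZ f z = cZ λ Φ Ψ k → replace f {Φ = Φ} {Ψ} (k z)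

-- ⟦ ! A ⟧ is generated by banged antecedents: this makes !R sound, and the structural !-rules
-- then act on the generators through the block lemmas.
⟦_⟧ : Fm → Pred
⟦ var n ⟧ = _⊢ᶜᶠ var n
⟦ 𝟘 ⟧ = cl (λ _ → ⊥)
⟦ 𝟙 ⟧ = cl ε
⟦ A ⟍ B ⟧ Γ = ∀ {Δ} → ⟦ A ⟧ Δ → ⟦ B ⟧ (Δ ++ Γ)
⟦ B ⟋ A ⟧ Γ = ∀ {Δ} → ⟦ A ⟧ Δ → ⟦ B ⟧ (Γ ++ Δ)
⟦ A ⊗ B ⟧ = cl (⟦ A ⟧ ⊙ ⟦ B ⟧)
⟦ A ⊕ B ⟧ = cl (λ Γ → ⟦ A ⟧ Γ ⊎ ⟦ B ⟧ Γ)
⟦ A & B ⟧ Γ = ⟦ A ⟧ Γ × ⟦ B ⟧ Γ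
⟦ A ⋆ ⟧ = cl (λ Γ → ∃ λ n → (⟦ A ⟧ ^ n) Γ)
⟦ ! A ⟧ = cl (λ Γ → Banged Γ × ⟦ A ⟧ Γ)

⟦⟧-closed : ∀ A → Closed ⟦ A ⟧
⟦⟧-closed (var n) = ⊢ᶜᶠ-closed
⟦⟧-closed 𝟘 = cl-closed
⟦⟧-closed 𝟙 = cl-closed
⟦⟧-closed (A ⟍ B) h {Δ} a = cl-rec (Closed-++ˡ Δ (⟦⟧-closed B)) (λ f → f a) h
⟦⟧-closed (B ⟋ A) h {Δ} a = cl-rec (Closed-++ʳ Δ (⟦⟧-closed B)) (λ f → f a) h
⟦⟧-closed (A ⊗ B) = cl-closed
⟦⟧-closed (A ⊕ B) = cl-closed
⟦⟧-closed (A & B) = Closed-× (⟦⟧-closed A) (⟦⟧-closed B)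
⟦⟧-closed (A ⋆) = cl-closed
⟦⟧-closed (! A) = cl-closed

^-tabulate : ∀ n → (X ^ n) Γ →
             Σ (Fin n → List Fm) λ Πs → Γ ≡ concat (tabulate Πs) × (∀ i → X (Πs i))
^-tabulate zero refl = (λ ()) , refl , (λ ())
^-tabulate (suc n) (_∙_ {Γ} x p) with ^-tabulate n p
... | Πs , refl , xs = (λ { zero → Γ ; (suc i) → Πs i }) , refl , (λ { zero → x ; (suc i) → xs i })

^-replicate : ∀ n → X [ A ] → (X ^ n) (replicate n A)
^-replicate zero x = refl
^-replicate (suc n) x = x ∙ ^-replicate n x

⋆R-^ : ∀ n → (∀ {Δ} → X Δ → Δ ⊢ᶜᶠ A) → (X ^ n) Γ → Γ ⊢ᶜᶠ A ⋆
⋆R-^ zero f refl = ax⋆ _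
⋆R-^ (suc n) f p with ^-tabulate (suc n) p
... | Πs , refl , xs = ⋆Rn n Πs (λ i → f (xs i))

mutual
  reify : ∀ A → ⟦ A ⟧ Γ → Γ ⊢ᶜᶠ A
  reify (var n) d = d
  reify 𝟘 = cl-rec ⊢ᶜᶠ-closed λ ()
  reify 𝟙 = cl-rec ⊢ᶜᶠ-closed λ { refl → ax𝟙 }
  reify (A ⟍ B) f = ⟍R (reify B (f (reflect A)))
  reify (B ⟋ A) f = ⟋R (reify B (f (reflect A)))
  reify (A ⊗ B) = cl-rec ⊢ᶜᶠ-closed λ { (a ∙ b) → ⊗R (reify A a) (reify B b) }
  reify (A ⊕ B) = cl-rec ⊢ᶜᶠ-closed λ { (inj₁ a) → ⊕R₁ (reify A a) ; (inj₂ b) → ⊕R₂ (reify B b) }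
  reify (A & B) (a , b) = &R (reify A a) (reify B b)
  reify (A ⋆) = cl-rec ⊢ᶜᶠ-closed λ { (n , p) → ⋆R-^ n (reify A) p }
  reify (! A) = cl-rec ⊢ᶜᶠ-closed λ { (by , a) → !R by (reify A a) }

  reflect : ∀ A → ⟦ A ⟧ [ A ]
  reflect (var n) = ax (var n)
  reflect 𝟘 Φ Ψ {C} _ = ax𝟘 Φ Ψ C
  reflect 𝟙 Φ Ψ k = 𝟙L {Γ = Φ} (k refl)
  reflect (A ⟍ B) {Δ} a = ⟦⟧-closed B λ Φ Ψ k →
    cast (cong (Φ ++_) (sym (++-assoc Δ [ A ⟍ B ] Ψ))) (⟍L {Γ = Φ} (reify A a) (k (reflect B)))
  reflect (B ⟋ A) a = ⟦⟧-closed B λ Φ Ψ k → ⟋L {Γ = Φ} (reify A a) (k (reflect B))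
  reflect (A ⊗ B) Φ Ψ k = ⊗L {Γ = Φ} (k (reflect A ∙ reflect B))
  reflect (A ⊕ B) Φ Ψ k = ⊕L {Γ = Φ} (k (inj₁ (reflect A))) (k (inj₂ (reflect B)))
  reflect (A & B) = ⟦⟧-closed A (λ Φ Ψ k → &L₁ {Γ = Φ} (k (reflect A))) ,
                    ⟦⟧-closed B (λ Φ Ψ k → &L₂ {Γ = Φ} (k (reflect B)))
  reflect (A ⋆) Φ Ψ k = ⋆Lω {Γ = Φ} λ n → k (n , ^-replicate n (reflect A))
  reflect (! A) Φ Ψ k = k ((A , refl) ∷ [] , ⟦⟧-closed A λ Φ′ Ψ′ k′ → !L {Γ = Φ′} (k′ (reflect A)))

data ⟦_⟧ᶜ : List Fm → Pred where
  []  : ⟦ [] ⟧ᶜ []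
  _∷_ : ⟦ A ⟧ Γ → ⟦ Π ⟧ᶜ Δ → ⟦ A ∷ Π ⟧ᶜ (Γ ++ Δ)

infix 4 _⊆ᶜ_

_⊆ᶜ_ : List Fm → Fm → Set
Π ⊆ᶜ C = ∀ {G} → ⟦ Π ⟧ᶜ G → ⟦ C ⟧ G

⟦⟧ᶜ-++⁺ : ∀ {Π₁ Π₂ G₁ G₂} → ⟦ Π₁ ⟧ᶜ G₁ → ⟦ Π₂ ⟧ᶜ G₂ → ⟦ Π₁ ++ Π₂ ⟧ᶜ (G₁ ++ G₂)
⟦⟧ᶜ-++⁺ [] s₂ = s₂
⟦⟧ᶜ-++⁺ {A ∷ Π₁} {Π₂} {G₂ = G₂} (_∷_ {Γ = Γ} {Δ = Δ} a s₁) s₂ =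
  subst ⟦ A ∷ Π₁ ++ Π₂ ⟧ᶜ (sym (++-assoc Γ Δ G₂)) (a ∷ ⟦⟧ᶜ-++⁺ s₁ s₂)

⟦⟧ᶜ-++⁻ : ∀ Π₁ {Π₂} → ⟦ Π₁ ++ Π₂ ⟧ᶜ G → (⟦ Π₁ ⟧ᶜ ⊙ ⟦ Π₂ ⟧ᶜ) G
⟦⟧ᶜ-++⁻ [] s = [] ∙ s
⟦⟧ᶜ-++⁻ (A ∷ Π₁) {Π₂} (_∷_ {Γ = Γ} a s) with ⟦⟧ᶜ-++⁻ Π₁ s
... | _∙_ {Γ₁} {Γ₂} s₁ s₂ = subst (⟦ A ∷ Π₁ ⟧ᶜ ⊙ ⟦ Π₂ ⟧ᶜ) (++-assoc Γ Γ₁ Γ₂) ((a ∷ s₁) ∙ s₂)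

^⇒⟦replicate⟧ᶜ : ∀ n → (⟦ A ⟧ ^ n) Γ → ⟦ replicate n A ⟧ᶜ Γ
^⇒⟦replicate⟧ᶜ zero refl = []
^⇒⟦replicate⟧ᶜ (suc n) (a ∙ p) = a ∷ ^⇒⟦replicate⟧ᶜ n p

⟦⟧ᶜ-reflect : ∀ Π → ⟦ Π ⟧ᶜ Π
⟦⟧ᶜ-reflect [] = []
⟦⟧ᶜ-reflect (A ∷ Π) = reflect A ∷ ⟦⟧ᶜ-reflect Π

⟦concat⟧ᶜ⇒^ : ∀ n (Πs : Fin n → List Fm) → (∀ i {G} → ⟦ Πs i ⟧ᶜ G → X G) →
              ⟦ concat (tabulate Πs) ⟧ᶜ G → (X ^ n) G
⟦concat⟧ᶜ⇒^ zero Πs f [] = refl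
⟦concat⟧ᶜ⇒^ (suc n) Πs f s with ⟦⟧ᶜ-++⁻ (Πs zero) s
... | s₁ ∙ s₂ = f zero s₁ ∙ ⟦concat⟧ᶜ⇒^ n (λ i → Πs (suc i)) (λ i → f (suc i)) s₂

⟦banged⟧ᶜ-rec : Banged Π → Closed Z → (∀ {y} → Banged y → ⟦ Π ⟧ᶜ y → Z y) → ⟦ Π ⟧ᶜ G → Z G
⟦banged⟧ᶜ-rec [] cZ f [] = f [] []
⟦banged⟧ᶜ-rec ((A , refl) ∷ bΠ) cZ f (_∷_ {Δ = G} x s) =
  cl-rec (Closed-++ʳ G cZ)
    (λ { {y} (by , a) → ⟦banged⟧ᶜ-rec bΠ (Closed-++ˡ y cZ)
                          (λ by′ s′ → f (++⁺ by by′) (cl-inc (by , a) ∷ s′)) s })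
    x

sound-⟍L : ∀ Γ Π C → Π ⊆ᶜ A → Γ ++ B ∷ Δ ⊆ᶜ C → Γ ++ Π ++ (A ⟍ B) ∷ Δ ⊆ᶜ C
sound-⟍L Γ Π C d e s with ⟦⟧ᶜ-++⁻ Γ s
... | _∙_ {G₁} s₁ sR with ⟦⟧ᶜ-++⁻ Π sR
... | _∙_ {GΠ} sΠ (_∷_ {Γ = X} {Δ = G₂} f s₂) =
  subst ⟦ C ⟧ (cong (G₁ ++_) (++-assoc GΠ X G₂)) (e (⟦⟧ᶜ-++⁺ s₁ (f (d sΠ) ∷ s₂)))

sound-⟋L : ∀ Γ Π C → Π ⊆ᶜ A → Γ ++ B ∷ Δ ⊆ᶜ C → Γ ++ (B ⟋ A) ∷ Π ++ Δ ⊆ᶜ C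
sound-⟋L Γ Π C d e s with ⟦⟧ᶜ-++⁻ Γ s
... | _∙_ {G₁} s₁ (_∷_ {Γ = X} f sR) with ⟦⟧ᶜ-++⁻ Π sR
... | _∙_ {GΠ} {G₂} sΠ s₂ =
  subst ⟦ C ⟧ (cong (G₁ ++_) (++-assoc X GΠ G₂)) (e (⟦⟧ᶜ-++⁺ s₁ (f (d sΠ) ∷ s₂)))

sound-!P₁ : ∀ Γ Π C → Γ ++ Π ++ (! A) ∷ Δ ⊆ᶜ C → Γ ++ (! A) ∷ Π ++ Δ ⊆ᶜ C
sound-!P₁ Γ Π C e s with ⟦⟧ᶜ-++⁻ Γ s
... | _∙_ {G₁} s₁ (_∷_ x sR) with ⟦⟧ᶜ-++⁻ Π sR
... | _∙_ {GΠ} {G₂} sΠ s₂ = cl-rec-in G₁ (GΠ ++ G₂) (⟦⟧-closed C)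
  (λ { y!@(by , _) → Closed-⇛ (⟦⟧-closed C) (⇛-++ˡ G₁ (!P₁-block {Γ = GΠ} {Δ = G₂} by))
                       (e (⟦⟧ᶜ-++⁺ s₁ (⟦⟧ᶜ-++⁺ sΠ (cl-inc y! ∷ s₂)))) })
  x

sound-!P₂ : ∀ Γ Π C → Γ ++ (! A) ∷ Π ++ Δ ⊆ᶜ C → Γ ++ Π ++ (! A) ∷ Δ ⊆ᶜ C
sound-!P₂ Γ Π C e s with ⟦⟧ᶜ-++⁻ Γ s
... | _∙_ {G₁} s₁ sR with ⟦⟧ᶜ-++⁻ Π sR
... | _∙_ {GΠ} sΠ (_∷_ {Δ = G₂} x s₂) =
  cl-rec (Closed-++ʳ G₂ (Closed-++ˡ GΠ (Closed-++ˡ G₁ (⟦⟧-closed C))))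
  (λ { y!@(by , _) → Closed-⇛ (⟦⟧-closed C) (⇛-++ˡ G₁ (!P₂-block {Γ = GΠ} {Δ = G₂} by))
                       (e (⟦⟧ᶜ-++⁺ s₁ (cl-inc y! ∷ ⟦⟧ᶜ-++⁺ sΠ s₂))) })
  x

sound-left : ∀ Γ C → (∀ {Γ′} → ⟦ A ⟧ Γ′ → cl X Γ′) →
             (∀ {G₁ y G₂} → ⟦ Γ ⟧ᶜ G₁ → X y → ⟦ Δ ⟧ᶜ G₂ → ⟦ C ⟧ (G₁ ++ y ++ G₂)) →
             ⟦ Γ ++ A ∷ Δ ⟧ᶜ G → ⟦ C ⟧ G
sound-left Γ C toCl k s with ⟦⟧ᶜ-++⁻ Γ s
... | _∙_ {G₁} s₁ (_∷_ {Δ = G₂} x s₂) =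
  cl-rec-in G₁ G₂ (⟦⟧-closed C) (λ y → k s₁ y s₂) (toCl x)

sound : Π ⊢ C → Π ⊆ᶜ C
sound (ax A) (_∷_ {Γ = Γ} a []) = subst ⟦ A ⟧ (sym (++-identityʳ Γ)) a
sound ax𝟙 [] = cl-inc refl
sound (ax𝟘 Γ Δ C) = sound-left Γ C id λ { _ () _ }
sound (ax⋆ A) [] = cl-inc (0 , refl)
sound (⟍L {Π = Π} {Γ = Γ} {C = C} d e) = sound-⟍L Γ Π C (sound d) (sound e)
sound (⟍R d) s a = sound d (a ∷ s)
sound (⟋L {Π = Π} {Γ = Γ} {C = C} d e) = sound-⟋L Γ Π C (sound d) (sound e)
sound (⟋R {B = B} d) {G} s {Δ} a =
  subst ⟦ B ⟧ (cong (G ++_) (++-identityʳ Δ)) (sound d (⟦⟧ᶜ-++⁺ s (a ∷ [])))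
sound (⊗L {Γ = Γ} {C = C} e) = sound-left Γ C id
  λ { {G₁} {G₂ = G₂} s₁ (_∙_ {Γ₁} {Γ₂} a b) s₂ →
      subst ⟦ C ⟧ (cong (G₁ ++_) (sym (++-assoc Γ₁ Γ₂ G₂))) (sound e (⟦⟧ᶜ-++⁺ s₁ (a ∷ b ∷ s₂))) }
sound (⊗R {Γ = Γ} d e) s with ⟦⟧ᶜ-++⁻ Γ s
... | s₁ ∙ s₂ = cl-inc (sound d s₁ ∙ sound e s₂)
sound (𝟙L {Γ = Γ} {C = C} e) = sound-left Γ C id λ { s₁ refl s₂ → sound e (⟦⟧ᶜ-++⁺ s₁ s₂) }
sound (⊕L {Γ = Γ} {C = C} d e) = sound-left Γ C id
  λ { s₁ (inj₁ a) s₂ → sound d (⟦⟧ᶜ-++⁺ s₁ (a ∷ s₂))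
    ; s₁ (inj₂ a) s₂ → sound e (⟦⟧ᶜ-++⁺ s₁ (a ∷ s₂)) }
sound (⊕R₁ d) s = cl-inc (inj₁ (sound d s))
sound (⊕R₂ d) s = cl-inc (inj₂ (sound d s))
sound (&L₁ {Γ = Γ} {C = C} e) =
  sound-left Γ C (cl-inc ∘ proj₁) λ s₁ a s₂ → sound e (⟦⟧ᶜ-++⁺ s₁ (a ∷ s₂))
sound (&L₂ {Γ = Γ} {C = C} e) =
  sound-left Γ C (cl-inc ∘ proj₂) λ s₁ a s₂ → sound e (⟦⟧ᶜ-++⁺ s₁ (a ∷ s₂))
sound (&R d e) s = sound d s , sound e s
sound (⋆Lω {Γ = Γ} {C = C} f) = sound-left Γ C id
  λ { s₁ (n , p) s₂ → sound (f n) (⟦⟧ᶜ-++⁺ s₁ (⟦⟧ᶜ-++⁺ (^⇒⟦replicate⟧ᶜ n p) s₂)) }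
sound (⋆Rn k Πs f) s = cl-inc (suc k , ⟦concat⟧ᶜ⇒^ (suc k) Πs (λ i → sound (f i)) s)
sound (cut {Π = Π} {Γ = Γ} d e) s with ⟦⟧ᶜ-++⁻ Γ s
... | s₁ ∙ sR with ⟦⟧ᶜ-++⁻ Π sR
... | sΠ ∙ s₂ = sound e (⟦⟧ᶜ-++⁺ s₁ (sound d sΠ ∷ s₂))
sound (!L {Γ = Γ} {C = C} e) = sound-left Γ C id λ { s₁ (_ , a) s₂ → sound e (⟦⟧ᶜ-++⁺ s₁ (a ∷ s₂)) }
sound (!R bΠ d) = ⟦banged⟧ᶜ-rec bΠ cl-closed (λ by s → cl-inc (by , sound d s))
sound (!P₁ {Γ = Γ} {Π = Π} {C = C} e) = sound-!P₁ Γ Π C (sound e)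
sound (!P₂ {Γ = Γ} {Π = Π} {C = C} e) = sound-!P₂ Γ Π C (sound e)
sound (!W {Γ = Γ} {C = C} e) = sound-left Γ C id
  λ { {G₁} s₁ (by , _) s₂ →
      Closed-⇛ (⟦⟧-closed C) (⇛-++ˡ G₁ (!W-block by)) (sound e (⟦⟧ᶜ-++⁺ s₁ s₂)) }
sound (!C {Γ = Γ} {C = C} e) = sound-left Γ C id
  λ { {G₁} s₁ y!@(by , _) s₂ →
      Closed-⇛ (⟦⟧-closed C) (⇛-++ˡ G₁ (!C-block by))
        (sound e (⟦⟧ᶜ-++⁺ s₁ (cl-inc y! ∷ cl-inc y! ∷ s₂))) }

cut-elimination : Π ⊢ C → Π ⊢ᶜᶠ C
cut-elimination d = reify _ (sound d (⟦⟧ᶜ-reflect _))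

-- From cut-free derivations to the d-calculus

All-focus : ∀ {p} {P : Fm → Set p} Γ → All P (Γ ++ A ∷ Δ) → All P Γ × P A × All P Δ
All-focus Γ ps with ++⁻ Γ ps
... | pΓ , pA ∷ pΔ = pΓ , pA , pΔ

castᵈ : Γ ≡ Γ′ → Ξ ︔ Γ ⊢ᵈ C → Ξ ︔ Γ′ ⊢ᵈ C
castᵈ refl d = d

ProdOf-good : ProdOf P bs → Good P
ProdOf-good p𝟙 = tt
ProdOf-good (pvar b) = tt
ProdOf-good (pmul p q) = ProdOf-good p , ProdOf-good q

MonImp-good : MonImp A → Good A
MonImp-good (monimp p q) = ProdOf-good p , ProdOf-good q

ProdOf-Rᵈ : ProdOf Q cs → Ξ ︔ map var cs ⊢ᵈ Q
ProdOf-Rᵈ p𝟙 = ax𝟙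
ProdOf-Rᵈ (pvar b) = ax (var b)
ProdOf-Rᵈ (pmul {x = x} {xs} {y} {ys} p q) =
  castᵈ (sym (map-++ var (x ∷ xs) (y ∷ ys))) (⊗R (ProdOf-Rᵈ p) (ProdOf-Rᵈ q))

ProdOf-Lᵈ : ProdOf P bs → ∀ Γ Δ → Ξ ︔ Γ ++ map var bs ++ Δ ⊢ᵈ C → Ξ ︔ Γ ++ P ∷ Δ ⊢ᵈ C
ProdOf-Lᵈ p𝟙 Γ Δ d = 𝟙L {Γ = Γ} d
ProdOf-Lᵈ (pvar b) Γ Δ d = d
ProdOf-Lᵈ (pmul {Q = Q} {x = x} {xs} {y} {ys} p q) Γ Δ d =
  ⊗L {Γ = Γ} (ProdOf-Lᵈ p Γ (Q ∷ Δ)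
    (castᵈ (++-assoc Γ (map var (x ∷ xs)) (Q ∷ Δ))
      (ProdOf-Lᵈ q (Γ ++ map var (x ∷ xs)) Δ
        (castᵈ (trans (cong (λ Θ → Γ ++ Θ ++ Δ) (map-++ var (x ∷ xs) (y ∷ ys)))
                      (++-regroup Γ (map var (x ∷ xs)) (map var (y ∷ ys)) Δ)) d))))

≈-refl : Ξ ≈ Ξ
≈-refl F = id , id

∈⇒≈ : A ∈ Ξ → Ξ ≈ (A ∷ Ξ)
∈⇒≈ m F = there , λ { (here refl) → m ; (there m′) → m′ }

zone-axᵈ : MonImp A → A ∈ Ξ → Ξ ︔ [] ⊢ᵈ A
zone-axᵈ (monimp {cs = cs} p q) m =
  ⟍R (ProdOf-Lᵈ p [] [] (Aᵈ {Γ = []} {Δ = []} p q (∈⇒≈ m)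
    (castᵈ (sym (++-identityʳ (map var cs))) (ProdOf-Rᵈ q))))

zone-cutᵈ : MonImp A → A ∈ Ξ → Ξ ︔ Γ ++ A ∷ Δ ⊢ᵈ C → Ξ ︔ Γ ++ Δ ⊢ᵈ C
zone-cutᵈ {Γ = Γ} {Δ = Δ} mi m = cutᵈ₁ {Π = []} {Γ = Γ} {Δ = Δ} (MonImp-good mi) (zone-axᵈ mi m)

zone-cut-!ᵈ : MonImp A → A ∈ Ξ → Ξ ︔ Γ ++ ! A ∷ Δ ⊢ᵈ C → Ξ ︔ Γ ++ Δ ⊢ᵈ C
zone-cut-!ᵈ {Γ = Γ} {Δ = Δ} mi m = cutᵈ₁ {Π = []} {Γ = Γ} {Δ = Δ} mi (!Rᵈ (zone-axᵈ mi m))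

!R-zoneᵈ : Banged Π → All Good Π → (∀ {Ξ′} → Ξ ⊆ Ξ′ → Ξ′ ︔ Π ⊢ᵈ B) → Ξ ︔ Π ⊢ᵈ ! B
!R-zoneᵈ [] [] f = !Rᵈ (f id)
!R-zoneᵈ {Π = _ ∷ Π} ((A , refl) ∷ bΠ) (mi ∷ gΠ) f =
  !Lᵈ {Γ = []} mi ≈-refl
    (!R-zoneᵈ bΠ gΠ λ sub → zone-cut-!ᵈ {Γ = []} mi (sub (here refl)) (f (sub ∘ there)))

!P₁ᵈ : MonImp A → ∀ Γ Π → (A ∷ Ξ) ︔ Γ ++ Π ++ ! A ∷ Δ ⊢ᵈ C → Ξ ︔ Γ ++ ! A ∷ Π ++ Δ ⊢ᵈ C
!P₁ᵈ {Δ = Δ} mi Γ Π d =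
  !Lᵈ mi ≈-refl (castᵈ (++-assoc Γ Π Δ)
    (zone-cut-!ᵈ {Γ = Γ ++ Π} mi (here refl) (castᵈ (sym (++-assoc Γ Π _)) d)))

!P₂ᵈ : MonImp A → ∀ Γ Π → (A ∷ Ξ) ︔ Γ ++ ! A ∷ Π ++ Δ ⊢ᵈ C → Ξ ︔ Γ ++ Π ++ ! A ∷ Δ ⊢ᵈ C
!P₂ᵈ {Δ = Δ} mi Γ Π d =
  castᵈ (++-assoc Γ Π _) (!Lᵈ {Γ = Γ ++ Π} mi ≈-refl
    (castᵈ (sym (++-assoc Γ Π Δ)) (zone-cut-!ᵈ {Γ = Γ} mi (here refl) d)))

⊢ᶜᶠ⇒⊢ᵈ : Π ⊢ᶜᶠ C → All Good Π → Good C → Ξ ︔ Π ⊢ᵈ C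
⊢ᶜᶠ⇒⊢ᵈ (ax A) _ _ = ax A
⊢ᶜᶠ⇒⊢ᵈ ax𝟙 _ _ = ax𝟙
⊢ᶜᶠ⇒⊢ᵈ (ax𝟘 Γ Δ C) _ _ = ax𝟘 Γ Δ C
⊢ᶜᶠ⇒⊢ᵈ (ax⋆ A) _ _ = ax⋆ A
⊢ᶜᶠ⇒⊢ᵈ (⟍L {Π = Π} {Γ = Γ} d e) gs gC =
  let gΓ , gΠ⋯ = ++⁻ Γ gs ; gΠ , (gA , gB) , gΔ = All-focus Π gΠ⋯
  in ⟍L (⊢ᶜᶠ⇒⊢ᵈ d gΠ gA) (⊢ᶜᶠ⇒⊢ᵈ e (++⁺ gΓ (gB ∷ gΔ)) gC)
⊢ᶜᶠ⇒⊢ᵈ (⟍R d) gs (gA , gB) = ⟍R (⊢ᶜᶠ⇒⊢ᵈ d (gA ∷ gs) gB)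
⊢ᶜᶠ⇒⊢ᵈ (⟋L {Π = Π} {Γ = Γ} d e) gs gC =
  let gΓ , (gB , gA) , gΠΔ = All-focus Γ gs ; gΠ , gΔ = ++⁻ Π gΠΔ
  in ⟋L (⊢ᶜᶠ⇒⊢ᵈ d gΠ gA) (⊢ᶜᶠ⇒⊢ᵈ e (++⁺ gΓ (gB ∷ gΔ)) gC)
⊢ᶜᶠ⇒⊢ᵈ (⟋R d) gs (gB , gA) = ⟋R (⊢ᶜᶠ⇒⊢ᵈ d (++⁺ gs (gA ∷ [])) gB)
⊢ᶜᶠ⇒⊢ᵈ (⊗L {Γ = Γ} d) gs gC =
  let gΓ , (gA , gB) , gΔ = All-focus Γ gs in ⊗L (⊢ᶜᶠ⇒⊢ᵈ d (++⁺ gΓ (gA ∷ gB ∷ gΔ)) gC)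
⊢ᶜᶠ⇒⊢ᵈ (⊗R {Γ = Γ} d e) gs (gA , gB) =
  let gΓ , gΔ = ++⁻ Γ gs in ⊗R (⊢ᶜᶠ⇒⊢ᵈ d gΓ gA) (⊢ᶜᶠ⇒⊢ᵈ e gΔ gB)
⊢ᶜᶠ⇒⊢ᵈ (𝟙L {Γ = Γ} d) gs gC =
  let gΓ , _ , gΔ = All-focus Γ gs in 𝟙L (⊢ᶜᶠ⇒⊢ᵈ d (++⁺ gΓ gΔ) gC)
⊢ᶜᶠ⇒⊢ᵈ (⊕L {Γ = Γ} d e) gs gC =
  let gΓ , (g₁ , g₂) , gΔ = All-focus Γ gs
  in ⊕L (⊢ᶜᶠ⇒⊢ᵈ d (++⁺ gΓ (g₁ ∷ gΔ)) gC) (⊢ᶜᶠ⇒⊢ᵈ e (++⁺ gΓ (g₂ ∷ gΔ)) gC)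
⊢ᶜᶠ⇒⊢ᵈ (⊕R₁ d) gs (g₁ , _) = ⊕R₁ (⊢ᶜᶠ⇒⊢ᵈ d gs g₁)
⊢ᶜᶠ⇒⊢ᵈ (⊕R₂ d) gs (_ , g₂) = ⊕R₂ (⊢ᶜᶠ⇒⊢ᵈ d gs g₂)
⊢ᶜᶠ⇒⊢ᵈ (&L₁ {Γ = Γ} d) gs gC =
  let gΓ , (g₁ , _) , gΔ = All-focus Γ gs in &L₁ (⊢ᶜᶠ⇒⊢ᵈ d (++⁺ gΓ (g₁ ∷ gΔ)) gC)
⊢ᶜᶠ⇒⊢ᵈ (&L₂ {Γ = Γ} d) gs gC =
  let gΓ , (_ , g₂) , gΔ = All-focus Γ gs in &L₂ (⊢ᶜᶠ⇒⊢ᵈ d (++⁺ gΓ (g₂ ∷ gΔ)) gC)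
⊢ᶜᶠ⇒⊢ᵈ (&R d e) gs (g₁ , g₂) = &R (⊢ᶜᶠ⇒⊢ᵈ d gs g₁) (⊢ᶜᶠ⇒⊢ᵈ e gs g₂)
⊢ᶜᶠ⇒⊢ᵈ (⋆Lω {Γ = Γ} f) gs gC =
  let gΓ , gA , gΔ = All-focus Γ gs
  in ⋆Lω λ n → ⊢ᶜᶠ⇒⊢ᵈ (f n) (++⁺ gΓ (++⁺ (replicate⁺ n gA) gΔ)) gC
⊢ᶜᶠ⇒⊢ᵈ (⋆Rn k Πs f) gs gA = ⋆Rn k Πs λ i → ⊢ᶜᶠ⇒⊢ᵈ (f i) (tabulate⁻ {f = Πs} (concat⁻ gs) i) gA
⊢ᶜᶠ⇒⊢ᵈ (!L {Γ = Γ} d) gs gC =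
  let gΓ , mi , gΔ = All-focus Γ gs
  in !Lᵈ mi ≈-refl (zone-cutᵈ mi (here refl) (⊢ᶜᶠ⇒⊢ᵈ d (++⁺ gΓ (MonImp-good mi ∷ gΔ)) gC))
⊢ᶜᶠ⇒⊢ᵈ (!R bΠ d) gs mi = !R-zoneᵈ bΠ gs λ _ → ⊢ᶜᶠ⇒⊢ᵈ d gs (MonImp-good mi)
⊢ᶜᶠ⇒⊢ᵈ (!P₁ {Γ = Γ} {Π = Π} d) gs gC =
  let gΓ , mi , gΠΔ = All-focus Γ gs ; gΠ , gΔ = ++⁻ Π gΠΔ
  in !P₁ᵈ mi Γ Π (⊢ᶜᶠ⇒⊢ᵈ d (++⁺ gΓ (++⁺ gΠ (mi ∷ gΔ))) gC)
⊢ᶜᶠ⇒⊢ᵈ (!P₂ {Γ = Γ} {Π = Π} d) gs gC =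
  let gΓ , gΠ⋯ = ++⁻ Γ gs ; gΠ , mi , gΔ = All-focus Π gΠ⋯
  in !P₂ᵈ mi Γ Π (⊢ᶜᶠ⇒⊢ᵈ d (++⁺ gΓ (mi ∷ ++⁺ gΠ gΔ)) gC)
⊢ᶜᶠ⇒⊢ᵈ (!W {Γ = Γ} d) gs gC =
  let gΓ , mi , gΔ = All-focus Γ gs in !Lᵈ mi ≈-refl (⊢ᶜᶠ⇒⊢ᵈ d (++⁺ gΓ gΔ) gC)
⊢ᶜᶠ⇒⊢ᵈ (!C {Γ = Γ} d) gs gC =
  let gΓ , mi , gΔ = All-focus Γ gs
  in !Lᵈ mi ≈-refl (zone-cut-!ᵈ mi (here refl) (zone-cut-!ᵈ mi (here refl)
       (⊢ᶜᶠ⇒⊢ᵈ d (++⁺ gΓ (mi ∷ mi ∷ gΔ)) gC)))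

-- From the d-calculus to !ACT_ω

ProdOf-R : ProdOf P bs → map var bs ⊢[ b ] P
ProdOf-R p𝟙 = ax𝟙
ProdOf-R (pvar b) = ax (var b)
ProdOf-R (pmul {x = x} {xs} {y} {ys} p q) =
  cast (sym (map-++ var (x ∷ xs) (y ∷ ys))) (⊗R (ProdOf-R p) (ProdOf-R q))

ProdOf-L : ProdOf P bs → map var bs ⇛ [ P ]
replace (ProdOf-L p𝟙) {Φ = Φ} = 𝟙L {Γ = Φ}
ProdOf-L (pvar b) = ⇛-refl
ProdOf-L (pmul {P = P} {x = x} {xs} {y} {ys} p q) =
  ⇛-trans (≡⇒⇛ (map-++ var (x ∷ xs) (y ∷ ys)))
    (⇛-trans (⇛-++ʳ (map var (y ∷ ys)) (ProdOf-L p))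
      (⇛-trans (⇛-++ˡ [ P ] (ProdOf-L q)) ⊗L⇛))

⟍L⇛ : (∀ {b} → Π ⊢[ b ] A) → [ B ] ⇛ Π ++ [ A ⟍ B ]
replace (⟍L⇛ {Π} {A} {B} d) {Φ = Φ} {Ψ} e =
  cast (cong (Φ ++_) (sym (++-assoc Π [ A ⟍ B ] Ψ))) (⟍L {Γ = Φ} d e)

A-rule⇛ : ProdOf P bs → ProdOf Q cs → map var cs ⇛ ! (P ⟍ Q) ∷ map var bs
A-rule⇛ {bs = bs} p q =
  ⇛-trans (ProdOf-L q)
    (⇛-trans (⟍L⇛ (ProdOf-R p))
      (⇛-trans (⇛-++ˡ (map var bs) !L⇛)
        (⇛-trans (!P₁⇛ {Γ = map var bs} {Δ = []})
          (≡⇒⇛ (cong (_ ∷_) (++-identityʳ (map var bs)))))))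

![_] : List Fm → List Fm
![ Ξ ] = map !_ Ξ

![]-banged : ∀ Ξ → Banged ![ Ξ ]
![]-banged [] = []
![]-banged (A ∷ Ξ) = (A , refl) ∷ ![]-banged Ξ

![]-absorb : A ∈ Ξ → ![ Ξ ] ++ ! A ∷ Γ ⇛ ![ Ξ ] ++ Γ
![]-absorb {Ξ = A ∷ Ξ} {Γ} (here refl) = ⇛-trans (⇛-++ˡ [ ! A ] (!P₁⇛ {Γ = ![ Ξ ]} {Δ = Γ})) !C⇛
![]-absorb {Ξ = B ∷ Ξ} (there m) = ⇛-++ˡ [ ! B ] (![]-absorb m)

![]-mono : ∀ {Ξ Ξ′} → Ξ ⊆ Ξ′ → ![ Ξ ] ++ Γ ⇛ ![ Ξ′ ] ++ Γ
![]-mono {Γ = Γ} {Ξ} {Ξ′} sub = ⇛-trans (!W-block (![]-banged Ξ′)) (absorb-all Ξ sub)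
  where
  absorb-all : ∀ Ξ → Ξ ⊆ Ξ′ → ![ Ξ′ ] ++ ![ Ξ ] ++ Γ ⇛ ![ Ξ′ ] ++ Γ
  absorb-all [] _ = ⇛-refl
  absorb-all (A ∷ Ξ) sub = ⇛-trans (![]-absorb (sub (here refl))) (absorb-all Ξ (sub ∘ there))

≈⇒⊆ : ∀ {Ξ Ξ′} → Ξ ≈ Ξ′ → Ξ ⊆ Ξ′
≈⇒⊆ eq = proj₁ (eq _)

≈⇒⊇ : ∀ {Ξ Ξ′} → Ξ ≈ Ξ′ → Ξ′ ⊆ Ξ
≈⇒⊇ eq = proj₂ (eq _)

!concat-block : Banged y → ∀ n (Πs : Fin n → List Fm) →
                concat (tabulate (λ i → y ++ Πs i)) ⇛ y ++ concat (tabulate Πs)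
!concat-block by zero Πs = !W-block by
!concat-block {y} by (suc n) Πs =
  ⇛-trans (≡⇒⇛ (++-assoc y (Πs zero) _))
    (⇛-trans (⇛-++ˡ y (⇛-++ˡ (Πs zero) (!concat-block by n (λ i → Πs (suc i)))))
      (!merge-block by (Πs zero)))

⊢-assoc : ∀ Z Γ → (Z ++ Γ) ++ Δ ⊢[ b ] C → Z ++ Γ ++ Δ ⊢[ b ] C
⊢-assoc Z Γ = cast (++-assoc Z Γ _)

⊢-assoc⁻ : ∀ Z Γ → Z ++ Γ ++ Δ ⊢[ b ] C → (Z ++ Γ) ++ Δ ⊢[ b ] C
⊢-assoc⁻ Z Γ = cast (sym (++-assoc Z Γ _))

!merge-⊢ : Banged y → ∀ Γ Π → (y ++ Γ) ++ (y ++ Π) ++ Δ ⊢[ b ] C → y ++ Γ ++ Π ++ Δ ⊢[ b ] C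
!merge-⊢ {y} {Δ} by Γ Π d =
  ⇛-apply (!merge-block by Γ)
    (cast (trans (++-assoc y Γ _) (cong (λ Θ → y ++ Γ ++ Θ) (++-assoc y Π Δ))) d)

!Lᵈ⇛ : ∀ {Ξ Ξ′} → Ξ′ ⊆ A ∷ Ξ → ![ Ξ′ ] ++ Γ ++ Δ ⇛ ![ Ξ ] ++ Γ ++ ! A ∷ Δ
!Lᵈ⇛ {Γ = Γ} {Δ} {Ξ} sub =
  ⇛-trans (![]-mono sub)
    (⇛-trans (!P₂⇛ {Γ = ![ Ξ ]} {Δ = Γ ++ Δ}) (⇛-++ˡ ![ Ξ ] (!P₂⇛ {Γ = Γ} {Δ = Δ})))

Aᵈ⇛ : ∀ {Ξ Ξ′} → ProdOf P bs → ProdOf Q cs → (P ⟍ Q) ∷ Ξ ⊆ Ξ′ →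
      ![ Ξ ] ++ Γ ++ map var cs ++ Δ ⇛ ![ Ξ′ ] ++ Γ ++ map var bs ++ Δ
Aᵈ⇛ {bs = bs} {Γ = Γ} {Δ} {Ξ} p q sub =
  ⇛-trans (⇛-++ˡ ![ Ξ ] (⇛-++ˡ Γ (⇛-++ʳ Δ (A-rule⇛ p q))))
    (⇛-trans (⇛-++ˡ ![ Ξ ] (!P₁⇛ {Γ = Γ} {Δ = map var bs ++ Δ}))
      (⇛-trans (!P₁⇛ {Γ = ![ Ξ ]} {Δ = Γ ++ map var bs ++ Δ}) (![]-mono sub)))

⊢ᵈ⇒⊢ : Ξ ︔ Γ ⊢ᵈ C → ![ Ξ ] ++ Γ ⊢[ true ] C
⊢ᵈ⇒⊢ {Ξ} (ax A) = ⇛-apply (!W-block (![]-banged Ξ)) (ax A)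
⊢ᵈ⇒⊢ {Ξ} ax𝟙 = ⇛-apply (!W-block (![]-banged Ξ)) ax𝟙
⊢ᵈ⇒⊢ {Ξ} (ax𝟘 Γ Δ C) = ⊢-assoc ![ Ξ ] Γ (ax𝟘 (![ Ξ ] ++ Γ) Δ C)
⊢ᵈ⇒⊢ {Ξ} (ax⋆ A) = ⇛-apply (!W-block (![]-banged Ξ)) (ax⋆ A)
⊢ᵈ⇒⊢ {Ξ} (⟍L {Π = Π} {Γ = Γ} d e) =
  !merge-⊢ (![]-banged Ξ) Γ Π (⟍L (⊢ᵈ⇒⊢ d) (⊢-assoc⁻ ![ Ξ ] Γ (⊢ᵈ⇒⊢ e)))
⊢ᵈ⇒⊢ {Ξ} (⟍R {Π = Π} {A = A} d) =
  ⟍R (⇛-apply (!P₂-block {Γ = [ A ]} {Δ = Π} (![]-banged Ξ)) (⊢ᵈ⇒⊢ d))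
⊢ᵈ⇒⊢ {Ξ} (⟋L {Π = Π} {Γ = Γ} {Δ = Δ} {A} {B} d e) =
  cast (cong (![ Ξ ] ++_) (++-assoc Γ [ B ⟋ A ] (Π ++ Δ)))
    (!merge-⊢ (![]-banged Ξ) (Γ ++ [ B ⟋ A ]) Π
      (cast (trans (sym (++-assoc (![ Ξ ] ++ Γ) [ B ⟋ A ] _))
                   (cong (_++ _) (++-assoc ![ Ξ ] Γ [ B ⟋ A ])))
        (⟋L (⊢ᵈ⇒⊢ d) (⊢-assoc⁻ ![ Ξ ] Γ (⊢ᵈ⇒⊢ e)))))
⊢ᵈ⇒⊢ {Ξ} (⟋R {Π = Π} {A = A} d) = ⟋R (cast (sym (++-assoc ![ Ξ ] Π [ A ])) (⊢ᵈ⇒⊢ d))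
⊢ᵈ⇒⊢ {Ξ} (⊗L {Γ = Γ} d) = ⊢-assoc ![ Ξ ] Γ (⊗L (⊢-assoc⁻ ![ Ξ ] Γ (⊢ᵈ⇒⊢ d)))
⊢ᵈ⇒⊢ {Ξ} (⊗R {Γ = Γ} d e) =
  ⇛-apply (!merge-block (![]-banged Ξ) Γ) (⊢-assoc ![ Ξ ] Γ (⊗R (⊢ᵈ⇒⊢ d) (⊢ᵈ⇒⊢ e)))
⊢ᵈ⇒⊢ {Ξ} (𝟙L {Γ = Γ} d) = ⊢-assoc ![ Ξ ] Γ (𝟙L (⊢-assoc⁻ ![ Ξ ] Γ (⊢ᵈ⇒⊢ d)))
⊢ᵈ⇒⊢ {Ξ} (⊕L {Γ = Γ} d e) =
  ⊢-assoc ![ Ξ ] Γ (⊕L (⊢-assoc⁻ ![ Ξ ] Γ (⊢ᵈ⇒⊢ d)) (⊢-assoc⁻ ![ Ξ ] Γ (⊢ᵈ⇒⊢ e)))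
⊢ᵈ⇒⊢ (⊕R₁ d) = ⊕R₁ (⊢ᵈ⇒⊢ d)
⊢ᵈ⇒⊢ (⊕R₂ d) = ⊕R₂ (⊢ᵈ⇒⊢ d)
⊢ᵈ⇒⊢ {Ξ} (&L₁ {Γ = Γ} d) = ⊢-assoc ![ Ξ ] Γ (&L₁ (⊢-assoc⁻ ![ Ξ ] Γ (⊢ᵈ⇒⊢ d)))
⊢ᵈ⇒⊢ {Ξ} (&L₂ {Γ = Γ} d) = ⊢-assoc ![ Ξ ] Γ (&L₂ (⊢-assoc⁻ ![ Ξ ] Γ (⊢ᵈ⇒⊢ d)))
⊢ᵈ⇒⊢ (&R d e) = &R (⊢ᵈ⇒⊢ d) (⊢ᵈ⇒⊢ e)
⊢ᵈ⇒⊢ {Ξ} (⋆Lω {Γ = Γ} f) = ⊢-assoc ![ Ξ ] Γ (⋆Lω λ n → ⊢-assoc⁻ ![ Ξ ] Γ (⊢ᵈ⇒⊢ (f n)))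
⊢ᵈ⇒⊢ {Ξ} (⋆Rn k Πs f) =
  ⇛-apply (!concat-block (![]-banged Ξ) (suc k) Πs) (⋆Rn k (λ i → ![ Ξ ] ++ Πs i) λ i → ⊢ᵈ⇒⊢ (f i))
⊢ᵈ⇒⊢ (!Lᵈ _ eq d) = ⇛-apply (!Lᵈ⇛ (≈⇒⊆ eq)) (⊢ᵈ⇒⊢ d)
⊢ᵈ⇒⊢ (!Rᵈ {Ξ} d) =
  cast (sym (++-identityʳ ![ Ξ ])) (!R (![]-banged Ξ) (cast (++-identityʳ ![ Ξ ]) (⊢ᵈ⇒⊢ d)))
⊢ᵈ⇒⊢ (Aᵈ {Γ = Γ} p q eq d) = ⇛-apply (Aᵈ⇛ {Γ = Γ} p q (≈⇒⊇ eq)) (⊢ᵈ⇒⊢ d)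
⊢ᵈ⇒⊢ {Ξ} (cutᵈ₁ {Π = Π} {Γ = Γ} _ d e) =
  !merge-⊢ (![]-banged Ξ) Γ Π (cut (⊢ᵈ⇒⊢ d) (⊢-assoc⁻ ![ Ξ ] Γ (⊢ᵈ⇒⊢ e)))
⊢ᵈ⇒⊢ {Ξ} (cutᵈ₂ _ eq d e) =
  ⇛-apply (!C-block (![]-banged Ξ))
    (cut {Γ = []} (!R (![]-banged Ξ) (cast (++-identityʳ ![ Ξ ]) (⊢ᵈ⇒⊢ d)))
      (⇛-apply (![]-mono (≈⇒⊆ eq)) (⊢ᵈ⇒⊢ e)))

proposition3p4 : (Π : List Fm) (C : Fm) → All Good Π → Good C →
                 (Π ⊢ C) ⇔ ([] ︔ Π ⊢ᵈ C)
proposition3p4 Π C gΠ gC =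
  mk⇔ (λ d → ⊢ᶜᶠ⇒⊢ᵈ (cut-elimination d) gΠ gC) (λ d → embed (⊢ᵈ⇒⊢ d))
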